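{- Suppose that during the decomposition algorithm a refined segment $[b_c,j]$ is appended to $\mathrm{RS}[c]$ while processing column $j$, and let $c'=\phi_j(c)\ge 1$. If, at that moment, $\mathrm{RS}[c']$ is non-empty and the right endpoint of its most recently appended refined segment is smaller than $j$, then $[b_c,j]$ overlaps strictly fewer than $d$ of the refined segments currently in $\mathrm{RS}[c']$.
   Context: Setting: haplotypes $S_1,\dots,S_h$ of length $m$; prefix array $\mathrm{PA}$ ($h\times m$, column $1$ is $1,\dots,h$, column $j>1$ sorts indices by co-lexicographic order of $S_i[1..j-1]$, ties broken stably); PBWT with $\mathrm{col}_j(\mathrm{PBWT})[x]=S_{\mathrm{col}_j(\mathrm{PA})[x]}[j]$; $(x,j)$ is a run-top if $x=1$ or $\mathrm{col}_j(\mathrm{PBWT})[x]\ne\mathrm{col}_j(\mathrm{PBWT})[x-1]$. For $\mathrm{col}_j(\mathrm{PA})[x]=i$: $\phi_j(i)=0$ if $x=1$, else $\phi_j(i)=\mathrm{col}_j(\mathrm{PA})[x-1]$. Haplotype intervals of $S_i$: with $b_1<\dots<b_k=m$ the set of $m$ and all columns $j$ such that some run-top $(x,j)$ has $\mathrm{col}_j(\mathrm{PA})[x]=i$, they are $[1,b_1],[b_1+1,b_2],\dots,[b_{k-1}+1,b_k]$. Two intervals overlap if they share an integer. Decomposition algorithm with integer parameter $d>1$: initially, for each $c$, $L_c$ is the linked list of haplotype intervals of $S_c$ in increasing order and $\mathrm{RS}[c]$ is empty. For $j=1,\dots,m$ and, within each $j$, for $i=1,\dots,h$: let $c=\mathrm{col}_j(\mathrm{PA})[i]$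 and let $[b_c,e_c]$ be the first interval of $L_c$. If $j=e_c$, remove $[b_c,e_c]$ from $L_c$ and append it to the tail of $\mathrm{RS}[c]$ (Passive Split). Otherwise, if $i>1$ and $[b_c,j]$ overlaps exactly $d$ refined segments currently in $\mathrm{RS}[c']$, where $c'=\mathrm{col}_j(\mathrm{PA})[i-1]$, append $[b_c,j]$ to $\mathrm{RS}[c]$ and replace the head $[b_c,e_c]$ of $L_c$ by $[j+1,e_c]$ (Active Split). Intervals in the lists $\mathrm{RS}[\cdot]$ are called refined segments. -}

module Defs where

open import Data.Nat using (ℕ; zero; suc; _+_; _∸_; _≤ᵇ_; _<ᵇ_; _≡ᵇ_)
open import Data.Bool using (Bool; true; false; _∧_; _∨_; not; if_then_else_)
open import Data.Fin using (Fin; zero; suc; toℕ; inject₁)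
open import Data.Fin.Properties using () renaming (_≟_ to _≟ᶠ_)
open import Data.Maybe using (Maybe; just; nothing)
open import Data.Product using (_×_; _,_; proj₁; proj₂)
open import Data.Vec using (Vec; []; _∷_; lookup)
import Data.Vec as V
open import Data.List using (List; []; _∷_; _∷ʳ_; filterᵇ; upTo; map; length; foldl; take)
import Data.List as L
open import Data.Bool.ListAction using (any)
open import Relation.Nullary.Decidable using (⌊_⌋)

-- Conventions:
--  * haplotypes are indexed by Fin h (haplotype S_{k+1} is index k);
--  * columns are 1-based natural numbers j with 1 ≤ j ≤ m;
--  * S i j is the character S_i[j] (alphabet ℕ); only positions 1..m are ever read;
--  * PA positions x are Fin h (position 1 is zero, position x-1 of suc y is inject₁ y).

Interval : Set
Interval = ℕ × ℕ

range : ℕ → ℕ → List ℕ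
range b e = map (b +_) (upTo (suc e ∸ b))

overlaps : Interval → Interval → Bool
overlaps (b₁ , e₁) (b₂ , e₂) = any (λ t → (b₂ ≤ᵇ t) ∧ (t ≤ᵇ e₂)) (range b₁ e₁)

overlapCount : Interval → List Interval → ℕ
overlapCount I xs = length (filterᵇ (overlaps I) xs)

_==ᶠ_ : ∀ {h} → Fin h → Fin h → Bool
a ==ᶠ b = ⌊ a ≟ᶠ b ⌋

module Algo {h : ℕ} (S : Fin h → ℕ → ℕ) (m d : ℕ) where

  colexLt : ℕ → Fin h → Fin h → Bool
  colexLt zero    a b = false
  colexLt (suc k) a b =
    if S a (suc k) <ᵇ S b (suc k) then true
    else if S a (suc k) ≡ᵇ S b (suc k) then colexLt k a b
    else false

  colexEq : ℕ → Fin h → Fin h → Bool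
  colexEq zero    a b = true
  colexEq (suc k) a b = (S a (suc k) ≡ᵇ S b (suc k)) ∧ colexEq k a b

  -- a precedes b in column j of PA: co-lex order of S_·[1..j-1], ties broken
  -- stably (by the original order 1..h)
  precedes : ℕ → Fin h → Fin h → Bool
  precedes j a b = colexLt (j ∸ 1) a b ∨ (colexEq (j ∸ 1) a b ∧ (toℕ a <ᵇ toℕ b))

  insertBy : ∀ {n} → ℕ → Fin h → Vec (Fin h) n → Vec (Fin h) (suc n)
  insertBy j a []      = a ∷ []
  insertBy j a (b ∷ v) = if precedes j a b then a ∷ b ∷ v else b ∷ insertBy j a v

  sortBy : ∀ {n} → ℕ → Vec (Fin h) n → Vec (Fin h) n
  sortBy j []      = []
  sortBy j (a ∷ v) = insertBy j a (sortBy j v)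

  paCol : ℕ → Vec (Fin h) h
  paCol j = sortBy j (V.allFin h)

  pa : ℕ → Fin h → Fin h
  pa j x = lookup (paCol j) x

  pbwt : ℕ → Fin h → ℕ
  pbwt j x = S (pa j x) j

  runTop : ℕ → Fin h → Bool
  runTop j zero    = true
  runTop j (suc y) = not (pbwt j (suc y) ≡ᵇ pbwt j (inject₁ y))

  -- φ_j(i): the haplotype just above i in col_j(PA); nothing encodes φ_j(i) = 0
  phiScan : ∀ {n} → Fin h → Maybe (Fin h) → Vec (Fin h) n → Maybe (Fin h)
  phiScan i prev []      = nothing
  phiScan i prev (a ∷ v) = if a ==ᶠ i then prev else phiScan i (just a) v

  φ : ℕ → Fin h → Maybe (Fin h)
  φ j i = phiScan i nothing (paCol j)

  columns : List ℕ
  columns = map suc (upTo m)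

  breaks : Fin h → List ℕ
  breaks i = filterᵇ (λ j → (j ≡ᵇ m) ∨ any (λ x → runTop j x ∧ (pa j x ==ᶠ i)) (L.allFin h)) columns

  mkIntervals : ℕ → List ℕ → List Interval
  mkIntervals prev []       = []
  mkIntervals prev (b ∷ bs) = (suc prev , b) ∷ mkIntervals b bs

  hapIntervals : Fin h → List Interval
  hapIntervals i = mkIntervals zero (breaks i)

  record State : Set where
    constructor ⟨_,_⟩
    field
      Ls : Fin h → List Interval
      RS : Fin h → List Interval
  open State public

  refined : State → Fin h → List Interval
  refined st c = RS st c

  update : Fin h → List Interval → (Fin h → List Interval) → (Fin h → List Interval)
  update c v f c'' = if c'' ==ᶠ c then v else f c''

  initState : State
  initState = ⟨ hapIntervals , (λ _ → []) ⟩

  activeCond : ℕ → Fin h → ℕ → State → Bool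
  activeCond j zero    b st = false
  activeCond j (suc y) b st = overlapCount (b , j) (RS st (pa j (inject₁ y))) ≡ᵇ d

  -- processing position x (i.e. i = x+1) of column j
  step : ℕ → State → Fin h → State
  step j st x with Ls st (pa j x)
  ... | []             = st
  ... | (b , e) ∷ rest =
    if e ≡ᵇ j
    then ⟨ update c rest (Ls st) , update c (RS st c ∷ʳ (b , e)) (RS st) ⟩
    else if activeCond j x b st
    then ⟨ update c ((suc j , e) ∷ rest) (Ls st) , update c (RS st c ∷ʳ (b , j)) (RS st) ⟩
    else st
    where c = pa j x

  runColumn : ℕ → State → State
  runColumn j st = foldl (step j) st (L.allFin h)

  runColumns : ℕ → State
  runColumns zero    = initState
  runColumns (suc k) = runColumn (suc k) (runColumns k)

  stateBefore : ℕ → Fin h → State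
  stateBefore j x = foldl (step j) (runColumns (j ∸ 1)) (take (toℕ x) (L.allFin h))

  stateAfter : ℕ → Fin h → State
  stateAfter j x = step j (stateBefore j x) x

-- Column j is processed in PA order, so when c = col_j(PA)[x] appends a segment, its neighbour
-- c′ = φ_j(c) has already been processed; if c′ appended nothing ending at j, RS[c′] is still
-- what it was after column j - 1, and all of its segments end before j.  It therefore suffices
-- to maintain, after every column k, the invariant: whenever c′ is directly above c in
-- col_{k+1}(PA) and the first pending interval of c starts at b, the interval [b, k] overlaps
-- fewer than d segments of RS[c′].  Column k + 1 preserves it.  If c splits there, or has a
-- run-top there (which forces a split, k + 1 being one of its interval ends), its next interval
-- starts after k + 1 and overlaps nothing.  Otherwise c and the haplotype above it share their
-- character at k + 1, so they remain adjacent in the next column; RS[c′] has gained at most one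
-- segment, so the count is at most d, and it is not d because c made no active split.
module Submission where

open import Defs
open import Data.Bool using (Bool; true; false; T; T?; _∧_)
open import Data.Bool.ListAction using (any)
open import Data.Bool.Properties using (T-≡; T-∧; T-∨)
open import Data.Empty using (⊥-elim)
open import Data.Fin as Fin using (Fin; zero; suc; toℕ; inject₁)
open import Data.Fin.Properties
  using (toℕ-injective; toℕ-inject₁; ≤̄⇒inject₁<) renaming (_≟_ to _≟ᶠ_)
open import Data.List as List
  using (List; []; _∷_; _∷ʳ_; [_]; _++_; length; filter; filterᵇ; foldl; take; drop; tabulate)
open import Data.List.Membership.Propositional using (_∈_; _∉_; find; lose)
open import Data.List.Membership.Propositional.Properties
  using (∈-map⁺; ∈-map⁻; ∈-upTo⁺; ∈-upTo⁻; ∈-filter⁺; ∈-allFin)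
open import Data.List.Properties
  using (length-++; length-filter; filter-++; filter-none; filter-all; filter-reject;
         take-suc-tabulate; foldl-∷ʳ; foldl-++; take++drop≡id;
         ∷-injectiveʳ; ∷ʳ-injectiveʳ; map-upTo)
open import Data.List.Relation.Unary.All as All using (All; []; _∷_)
import Data.List.Relation.Unary.All.Properties as All
open import Data.List.Relation.Unary.AllPairs as AllPairs using (AllPairs; []; _∷_)
import Data.List.Relation.Unary.AllPairs.Properties as AllPairs
open import Data.List.Relation.Unary.Any using (here; there)
open import Data.List.Relation.Unary.Any.Properties using (any⁺; any⁻)
open import Data.Maybe using (just; nothing)
open import Data.Maybe.Properties using (just-injective)
open import Data.Nat using (ℕ; zero; suc; _+_; _∸_; _≤_; _<_; _<ᵇ_; _≡ᵇ_; z≤n; s≤s; z<s; s<s; s≤s⁻¹)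
open import Data.Nat.Properties
open import Data.Product using (Σ; ∃-syntax; _×_; _,_; proj₁; proj₂)
open import Data.Sum as Sum using (_⊎_; inj₁; inj₂)
open import Data.Vec using (Vec; []; _∷_; lookup)
open import Data.Vec.Membership.Propositional.Properties using (∈-allFin⁺)
open import Data.Vec.Relation.Unary.All as VAll using ([]; _∷_)
open import Data.Vec.Relation.Unary.All.Properties using (lookup⁺)
open import Data.Vec.Relation.Unary.AllPairs as VAllPairs using ([]; _∷_)
open import Data.Vec.Relation.Unary.Any as VAny using (Any; here; there)
open import Data.Vec.Relation.Unary.Any.Properties using (lookup-index)
open import Data.Vec.Relation.Unary.Unique.Propositional using (Unique)
import Data.Vec.Relation.Unary.Unique.Propositional.Properties as Unique
open import Function using (_∘_; flip; _⇔_; Equivalence; mk⇔)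
open import Relation.Binary.Definitions using (tri<; tri≈; tri>)
open import Relation.Binary.PropositionalEquality
  using (_≡_; _≢_; refl; sym; trans; cong; cong₂; subst; subst₂; module ≡-Reasoning)
open import Relation.Nullary using (¬_; yes; no)
open import Relation.Nullary.Decidable using (fromWitness)
open import Relation.Unary using (Decidable)

private variable
  A : Set

∈-range⁺ : ∀ {b e t} → b ≤ t → t ≤ e → t ∈ range b e
∈-range⁺ {b} b≤t t≤e =
  subst (_∈ _) (m+[n∸m]≡n b≤t) (∈-map⁺ (b +_) (∈-upTo⁺ (∸-monoˡ-< (s≤s t≤e) b≤t)))

∈-range⁻ : ∀ {b e t} → t ∈ range b e → b ≤ t × t ≤ e
∈-range⁻ {b} {e} t∈ with i , i< , refl ← ∈-map⁻ (b +_) t∈ =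
  m≤m+n b i , ≮⇒≥ (λ e<b+i → <⇒≱ (∈-upTo⁻ i<) (m≤n+o⇒m∸n≤o (suc e) b e<b+i))

overlaps⁺ : ∀ {b e b′ e′ t} → b ≤ t → t ≤ e → b′ ≤ t → t ≤ e′ →
  T (overlaps (b , e) (b′ , e′))
overlaps⁺ b≤t t≤e b′≤t t≤e′ =
  any⁺ _ (lose (∈-range⁺ b≤t t≤e) (Equivalence.from T-∧ (≤⇒≤ᵇ b′≤t , ≤⇒≤ᵇ t≤e′)))

overlaps⁻ : ∀ b e b′ e′ → T (overlaps (b , e) (b′ , e′)) →
  ∃[ t ] (b ≤ t × t ≤ e) × (b′ ≤ t × t ≤ e′)
overlaps⁻ b e b′ e′ ov with t , t∈ , bounds ← find (any⁻ _ (range b e) ov)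
  with b′≤ᵇt , t≤ᵇe′ ← Equivalence.to T-∧ bounds =
  t , ∈-range⁻ t∈ , ≤ᵇ⇒≤ b′ t b′≤ᵇt , ≤ᵇ⇒≤ t e′ t≤ᵇe′

overlaps-empty : ∀ b e s → e < b → ¬ T (overlaps (b , e) s)
overlaps-empty b e (b′ , e′) e<b ov with _ , (b≤t , t≤e) , _ ← overlaps⁻ b e b′ e′ ov =
  <⇒≱ e<b (≤-trans b≤t t≤e)

overlaps-suc⇔ : ∀ b k s → proj₂ s ≤ k → T (overlaps (b , suc k) s) ⇔ T (overlaps (b , k) s)
overlaps-suc⇔ b k (b′ , e′) e′≤k = mk⇔ shrink widen
  where
    shrink : T (overlaps (b , suc k) (b′ , e′)) → T (overlaps (b , k) (b′ , e′))
    shrink ov with _ , (b≤t , _) , (b′≤t , t≤e′) ← overlaps⁻ b (suc k) b′ e′ ov =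
      overlaps⁺ b≤t (≤-trans t≤e′ e′≤k) b′≤t t≤e′
    widen : T (overlaps (b , k) (b′ , e′)) → T (overlaps (b , suc k) (b′ , e′))
    widen ov with _ , (b≤t , t≤k) , (b′≤t , t≤e′) ← overlaps⁻ b k b′ e′ ov =
      overlaps⁺ b≤t (m≤n⇒m≤1+n t≤k) b′≤t t≤e′

filterᵇ-cong : ∀ {p q : A → Bool} {xs} → All (λ x → T (p x) ⇔ T (q x)) xs →
  filterᵇ p xs ≡ filterᵇ q xs
filterᵇ-cong [] = refl
filterᵇ-cong {p = p} {q} {x ∷ _} (px⇔qx ∷ eqs) with p x | q x
... | true  | true  = cong (x ∷_) (filterᵇ-cong eqs)
... | false | false = filterᵇ-cong eqs
... | true  | false = ⊥-elim (Equivalence.to px⇔qx _)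
... | false | true  = ⊥-elim (Equivalence.from px⇔qx _)

length-filterᵇ-∷ʳ : ∀ (p : A → Bool) xs x →
  length (filterᵇ p (xs ∷ʳ x)) ≤ suc (length (filterᵇ p xs))
length-filterᵇ-∷ʳ p xs x = begin
  length (filterᵇ p (xs ∷ʳ x))                     ≡⟨ cong length (filter-++ (T? ∘ p) xs [ x ]) ⟩
  length (filterᵇ p xs ++ filterᵇ p [ x ])         ≡⟨ length-++ (filterᵇ p xs) ⟩
  length (filterᵇ p xs) + length (filterᵇ p [ x ]) ≤⟨ +-monoʳ-≤ _ (length-filter (T? ∘ p) [ x ]) ⟩
  length (filterᵇ p xs) + 1                        ≡⟨ +-comm _ 1 ⟩
  suc (length (filterᵇ p xs))                      ∎
  where open ≤-Reasoning

filter-absorbs : ∀ {P Q : A → Set} (P? : Decidable P) (Q? : Decidable Q) →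
  (∀ {x} → P x → Q x) → ∀ xs → filter P? (filter Q? xs) ≡ filter P? xs
filter-absorbs P? Q? P⇒Q []       = refl
filter-absorbs P? Q? P⇒Q (x ∷ xs) with Q? x
... | no ¬qx = trans (filter-absorbs P? Q? P⇒Q xs) (sym (filter-reject P? (¬qx ∘ P⇒Q)))
... | yes _ with P? x
...   | yes _ = cong (x ∷_) (filter-absorbs P? Q? P⇒Q xs)
...   | no _  = filter-absorbs P? Q? P⇒Q xs

∷ʳ-≢ : ∀ (xs : List A) {x} → xs ∷ʳ x ≢ xs
∷ʳ-≢ []       ()
∷ʳ-≢ (_ ∷ xs) eq = ∷ʳ-≢ xs (∷-injectiveʳ eq)

All-take-tabulate : ∀ {P : A → Set} {l} (f : Fin l → A) t →
  (∀ i → toℕ i < t → P (f i)) → All P (take t (tabulate f))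
All-take-tabulate             f zero    _  = []
All-take-tabulate {l = zero}  f (suc t) _  = []
All-take-tabulate {l = suc l} f (suc t) Pf =
  Pf zero z<s ∷ All-take-tabulate (f ∘ suc) t (λ i i<t → Pf (suc i) (s<s i<t))

All-drop-tabulate : ∀ {P : A → Set} {l} (f : Fin l → A) t →
  (∀ i → t ≤ toℕ i → P (f i)) → All P (drop t (tabulate f))
All-drop-tabulate             f zero    Pf = All.tabulate⁺ (λ i → Pf i z≤n)
All-drop-tabulate {l = zero}  f (suc t) _  = []
All-drop-tabulate {l = suc l} f (suc t) Pf =
  All-drop-tabulate (f ∘ suc) t (λ i t≤i → Pf (suc i) (s≤s t≤i))

AllPairs-lookup : ∀ {R : A → A → Set} {l} {v : Vec A l} → VAllPairs.AllPairs R v →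
  ∀ {x y} → x Fin.< y → R (lookup v x) (lookup v y)
AllPairs-lookup (r ∷ _)  {zero}  {suc y} _         = lookup⁺ r y
AllPairs-lookup (_ ∷ rs) {suc x} {suc y} (s<s x<y) = AllPairs-lookup rs x<y

inject₁<⇒≮suc : ∀ {l} {q : Fin l} {r : Fin (suc l)} → inject₁ q Fin.< r → ¬ r Fin.< suc q
inject₁<⇒≮suc {q = q} {r} q<r r<q+1 =
  <-irrefl refl (<-≤-trans (subst (_< toℕ r) (toℕ-inject₁ q) q<r) (s≤s⁻¹ r<q+1))

<suc∧≢inject₁⇒< : ∀ {l} {q : Fin l} {r : Fin (suc l)} →
  r Fin.< suc q → r ≢ inject₁ q → r Fin.< inject₁ q
<suc∧≢inject₁⇒< {q = q} {r} r<q+1 r≢q =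
  ≤∧≢⇒< (subst (toℕ r ≤_) (sym (toℕ-inject₁ q)) (s≤s⁻¹ r<q+1)) (r≢q ∘ toℕ-injective)

EndsBy : ℕ → List Interval → Set
EndsBy k = All (λ s → proj₂ s ≤ k)

overlapCount-empty : ∀ b e xs → e < b → overlapCount (b , e) xs ≡ 0
overlapCount-empty b e xs e<b =
  cong length (filter-none _ (All.universal (λ s → overlaps-empty b e s e<b) xs))

overlapCount-suc : ∀ b k {xs} → EndsBy k xs → overlapCount (b , suc k) xs ≡ overlapCount (b , k) xs
overlapCount-suc b k ends = cong length (filterᵇ-cong (All.map (λ {s} → overlaps-suc⇔ b k s) ends))

ExtendsAt : ℕ → List Interval → List Interval → Set
ExtendsAt j xs ys = ys ≡ xs ⊎ ∃[ b ] ys ≡ xs ∷ʳ (b , j)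

ExtendsAt-ends : ∀ {k xs ys} → EndsBy k xs → ExtendsAt (suc k) xs ys → EndsBy (suc k) ys
ExtendsAt-ends ends (inj₁ refl)       = All.map m≤n⇒m≤1+n ends
ExtendsAt-ends ends (inj₂ (_ , refl)) = All.∷ʳ⁺ (All.map m≤n⇒m≤1+n ends) ≤-refl

overlapCount-ExtendsAt : ∀ b {k xs ys} → EndsBy k xs → ExtendsAt (suc k) xs ys →
  overlapCount (b , suc k) ys ≤ suc (overlapCount (b , k) xs)
overlapCount-ExtendsAt b {k} ends (inj₁ refl) = m≤n⇒m≤1+n (≤-reflexive (overlapCount-suc b k ends))
overlapCount-ExtendsAt b {k} {xs} ends (inj₂ (b′ , refl)) =
  ≤-trans (length-filterᵇ-∷ʳ (overlaps (b , suc k)) xs (b′ , suc k))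
          (s≤s (≤-reflexive (overlapCount-suc b k ends)))

ExtendsAt-last< : ∀ {j xs ys pre s} → ExtendsAt j xs ys → ys ≡ pre ∷ʳ s → proj₂ s < j → ys ≡ xs
ExtendsAt-last< (inj₁ ys≡xs) _ _ = ys≡xs
ExtendsAt-last< {xs = xs} {pre = pre} (inj₂ (_ , refl)) last s<j =
  ⊥-elim (<-irrefl (sym (cong proj₂ (∷ʳ-injectiveʳ xs pre last))) s<j)

after : ℕ → List ℕ → List ℕ
after k = filter (k <?_)

after-suc : ∀ k xs → after (suc k) (after k xs) ≡ after (suc k) xs
after-suc k = filter-absorbs (suc k <?_) (k <?_) (<-trans (n<1+n k))

after-suc-∷ : ∀ {k e es} xs → AllPairs _<_ xs → after k xs ≡ e ∷ es →
  (e ≡ suc k × after (suc k) xs ≡ es) ⊎ (suc k < e × after (suc k) xs ≡ e ∷ es × suc k ∉ xs)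
after-suc-∷ {k} {e} {es} xs xs↑ first
  with e<es ∷ _ ← subst (AllPairs _<_) first (AllPairs.filter⁺ (k <?_) xs↑)
  with k<e ∷ _  ← subst (All (k <_)) first (All.all-filter (k <?_) xs)
  with reduce ← trans (sym (after-suc k xs)) (cong (after (suc k)) first)
  with e ≟ suc k
... | yes refl =
  inj₁ (refl , trans reduce (trans (filter-reject (suc k <?_) (<-irrefl refl)) (filter-all (suc k <?_) e<es)))
... | no e≢k+1 =
  inj₂ (k+1<e , trans reduce (filter-all (suc k <?_) (k+1<e ∷ All.map (<-trans k+1<e) e<es)) , k+1∉xs)
  where
    k+1<e : suc k < e
    k+1<e = ≤∧≢⇒< k<e (e≢k+1 ∘ sym)
    k+1∉xs : suc k ∉ xs
    k+1∉xs k+1∈xs with subst (suc k ∈_) first (∈-filter⁺ (k <?_) k+1∈xs (n<1+n k))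
    ... | here k+1≡e   = <-irrefl k+1≡e k+1<e
    ... | there k+1∈es = <-asym k+1<e (All.lookup e<es k+1∈es)

module Decomposition {n : ℕ} (S : Fin (suc n) → ℕ → ℕ) (m d : ℕ) where
  open Algo S m d

  Hap : Set
  Hap = Fin (suc n)

  Colex : ℕ → Hap → Hap → Set
  Colex zero    a b = a Fin.< b
  Colex (suc k) a b = S a (suc k) < S b (suc k) ⊎ (S a (suc k) ≡ S b (suc k) × Colex k a b)

  precedes⇒Colex : ∀ k a b → T (precedes (suc k) a b) → Colex k a b
  precedes⇒Colex zero    a b p = <ᵇ⇒< _ _ p
  precedes⇒Colex (suc k) a b p
    with S a (suc k) <ᵇ S b (suc k) in lt | S a (suc k) ≡ᵇ S b (suc k) in eq
  ... | true  | _     = inj₁ (<ᵇ⇒< _ _ (Equivalence.from T-≡ lt))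
  ... | false | true  = inj₂ (≡ᵇ⇒≡ _ _ (Equivalence.from T-≡ eq) , precedes⇒Colex k a b p)

  Colex⇒precedes : ∀ k {a b} → Colex k a b → T (precedes (suc k) a b)
  Colex⇒precedes zero    a<b = <⇒<ᵇ a<b
  Colex⇒precedes (suc k) {a} {b} a≺b
    with S a (suc k) <ᵇ S b (suc k) in lt | S a (suc k) ≡ᵇ S b (suc k) in eq | a≺b
  ... | true  | _     | _               = _
  ... | false | _     | inj₁ sa<sb      = ⊥-elim (subst T lt (<⇒<ᵇ sa<sb))
  ... | false | true  | inj₂ (_ , a≺b′) = Colex⇒precedes k a≺b′
  ... | false | false | inj₂ (sa≡sb , _) = ⊥-elim (subst T eq (≡⇒≡ᵇ _ _ sa≡sb))

  Colex-irrefl : ∀ k {a} → ¬ Colex k a a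
  Colex-irrefl zero    a<a             = <-irrefl refl a<a
  Colex-irrefl (suc k) (inj₁ sa<sa)    = <-irrefl refl sa<sa
  Colex-irrefl (suc k) (inj₂ (_ , a≺a)) = Colex-irrefl k a≺a

  Colex-trans : ∀ k {a b c} → Colex k a b → Colex k b c → Colex k a c
  Colex-trans zero    a<b b<c = <-trans a<b b<c
  Colex-trans (suc k) (inj₁ a<b)        (inj₁ b<c)        = inj₁ (<-trans a<b b<c)
  Colex-trans (suc k) (inj₁ a<b)        (inj₂ (b≡c , _))  = inj₁ (<-≤-trans a<b (≤-reflexive b≡c))
  Colex-trans (suc k) (inj₂ (a≡b , _))  (inj₁ b<c)        = inj₁ (≤-<-trans (≤-reflexive a≡b) b<c)
  Colex-trans (suc k) (inj₂ (a≡b , a≺b)) (inj₂ (b≡c , b≺c)) =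
    inj₂ (trans a≡b b≡c , Colex-trans k a≺b b≺c)

  Colex-connex : ∀ k {a b} → a ≢ b → Colex k a b ⊎ Colex k b a
  Colex-connex zero {a} {b} a≢b with <-cmp (toℕ a) (toℕ b)
  ... | tri< a<b _ _ = inj₁ a<b
  ... | tri≈ _ a≡b _ = ⊥-elim (a≢b (toℕ-injective a≡b))
  ... | tri> _ _ b<a = inj₂ b<a
  Colex-connex (suc k) {a} {b} a≢b with <-cmp (S a (suc k)) (S b (suc k))
  ... | tri< sa<sb _ _ = inj₁ (inj₁ sa<sb)
  ... | tri> _ _ sb<sa = inj₂ (inj₁ sb<sa)
  ... | tri≈ _ sa≡sb _ = Sum.map (inj₂ ∘ (sa≡sb ,_)) (inj₂ ∘ (sym sa≡sb ,_)) (Colex-connex k a≢b)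

  Colex-suc⇒≤ : ∀ k {a b} → Colex (suc k) a b → S a (suc k) ≤ S b (suc k)
  Colex-suc⇒≤ k (inj₁ sa<sb)      = <⇒≤ sa<sb
  Colex-suc⇒≤ k (inj₂ (sa≡sb , _)) = ≤-reflexive sa≡sb

  Colex-suc-tie : ∀ k {a b} → S a (suc k) ≡ S b (suc k) → Colex (suc k) a b → Colex k a b
  Colex-suc-tie k sa≡sb (inj₁ sa<sb)  = ⊥-elim (<-irrefl sa≡sb sa<sb)
  Colex-suc-tie k _     (inj₂ (_ , a≺b)) = a≺b

  Colex-squeeze : ∀ k {a b c} → S a (suc k) ≡ S c (suc k) →
    Colex (suc k) a b → Colex (suc k) b c → Colex k a b × Colex k b c
  Colex-squeeze k sa≡sc a≺b b≺c =
    Colex-suc-tie k (≤-antisym sa≤sb (≤-trans sb≤sc (≤-reflexive (sym sa≡sc)))) a≺b ,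
    Colex-suc-tie k (≤-antisym sb≤sc (≤-trans (≤-reflexive (sym sa≡sc)) sa≤sb)) b≺c
    where
      sa≤sb = Colex-suc⇒≤ k a≺b
      sb≤sc = Colex-suc⇒≤ k b≺c

  Sorted : ℕ → ∀ {l} → Vec Hap l → Set
  Sorted k = VAllPairs.AllPairs (Colex k)

  All-insertBy : ∀ {P : Hap → Set} j {a l} {v : Vec Hap l} →
    P a → VAll.All P v → VAll.All P (insertBy j a v)
  All-insertBy j {v = []}    pa []        = pa ∷ []
  All-insertBy j {a} {v = b ∷ v} pa (pb ∷ pv) with precedes j a b
  ... | true  = pa ∷ pb ∷ pv
  ... | false = pb ∷ All-insertBy j pa pv

  All-sortBy : ∀ {P : Hap → Set} j {l} {v : Vec Hap l} → VAll.All P v → VAll.All P (sortBy j v)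
  All-sortBy j []        = []
  All-sortBy j (pa ∷ pv) = All-insertBy j pa (All-sortBy j pv)

  Any-insertBy : ∀ {P : Hap → Set} j {a l} {v : Vec Hap l} → P a ⊎ Any P v → Any P (insertBy j a v)
  Any-insertBy j {v = []} (inj₁ pa) = here pa
  Any-insertBy j {a} {v = b ∷ v} pa∨pv with precedes j a b | pa∨pv
  ... | true  | inj₁ pa         = here pa
  ... | true  | inj₂ pv         = there pv
  ... | false | inj₁ pa         = there (Any-insertBy j {v = v} (inj₁ pa))
  ... | false | inj₂ (here pb)  = here pb
  ... | false | inj₂ (there pv) = there (Any-insertBy j (inj₂ pv))

  Any-sortBy : ∀ {P : Hap → Set} j {l} {v : Vec Hap l} → Any P v → Any P (sortBy j v)
  Any-sortBy j {v = _ ∷ v} (here pa)  = Any-insertBy j {v = sortBy j v} (inj₁ pa)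
  Any-sortBy j {v = _ ∷ v} (there pv) = Any-insertBy j {v = sortBy j v} (inj₂ (Any-sortBy j pv))

  insertBy-sorted : ∀ k {a l} {v : Vec Hap l} →
    VAll.All (a ≢_) v → Sorted k v → Sorted k (insertBy (suc k) a v)
  insertBy-sorted k {v = []} [] [] = [] ∷ []
  insertBy-sorted k {a} {v = b ∷ v} (a≢b ∷ a∉v) (b≺v ∷ v-sorted) with precedes (suc k) a b in a≺b?
  ... | true  = (a≺b ∷ VAll.map (Colex-trans k a≺b) b≺v) ∷ b≺v ∷ v-sorted
    where a≺b = precedes⇒Colex k a b (Equivalence.from T-≡ a≺b?)
  ... | false = All-insertBy (suc k) b≺a b≺v ∷ insertBy-sorted k a∉v v-sorted
    where
      b≺a : Colex k b a
      b≺a with Colex-connex k a≢b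
      ... | inj₁ a≺b = ⊥-elim (subst T a≺b? (Colex⇒precedes k a≺b))
      ... | inj₂ b≺a = b≺a

  sortBy-sorted : ∀ k {l} {v : Vec Hap l} → Unique v → Sorted k (sortBy (suc k) v)
  sortBy-sorted k []            = []
  sortBy-sorted k (a∉v ∷ v-uniq) = insertBy-sorted k (All-sortBy (suc k) a∉v) (sortBy-sorted k v-uniq)

  paCol-sorted : ∀ k → Sorted k (paCol (suc k))
  paCol-sorted k = sortBy-sorted k (Unique.tabulate⁺ (λ eq → eq))

  pa-surjective : ∀ j c → ∃[ x ] pa j x ≡ c
  pa-surjective j c = let c∈ = Any-sortBy j (∈-allFin⁺ c) in VAny.index c∈ , sym (lookup-index c∈)

  pa-monotone : ∀ k {x y} → x Fin.< y → Colex k (pa (suc k) x) (pa (suc k) y)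
  pa-monotone k = AllPairs-lookup (paCol-sorted k)

  pa-injective : ∀ k {x y} → pa (suc k) x ≡ pa (suc k) y → x ≡ y
  pa-injective k = Unique.lookup-injective (VAllPairs.map Colex⇒≢ (paCol-sorted k)) _ _
    where
      Colex⇒≢ : ∀ {a b} → Colex k a b → a ≢ b
      Colex⇒≢ a≺b refl = Colex-irrefl k a≺b

  pa-reflects : ∀ k {x y} → Colex k (pa (suc k) x) (pa (suc k) y) → x Fin.< y
  pa-reflects k {x} {y} a≺b with <-cmp (toℕ x) (toℕ y)
  ... | tri< x<y _ _ = x<y
  ... | tri≈ _ x≡y _ with refl ← toℕ-injective x≡y = ⊥-elim (Colex-irrefl k a≺b)
  ... | tri> _ _ y<x = ⊥-elim (Colex-irrefl k (Colex-trans k a≺b (pa-monotone k y<x)))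

  Adjacent : ℕ → Hap → Hap → Set
  Adjacent j c′ c = ∃[ y ] pa j (inject₁ y) ≡ c′ × pa j (suc y) ≡ c

  HasRunTop : ℕ → Hap → Set
  HasRunTop j c = ∃[ x ] T (runTop j x) × pa j x ≡ c

  phiScan-just : ∀ {l} i prev (v : Vec Hap (suc l)) {c′} → phiScan i prev v ≡ just c′ →
    (lookup v zero ≡ i × prev ≡ just c′) ⊎ ∃[ y ] lookup v (suc y) ≡ i × lookup v (inject₁ y) ≡ c′
  phiScan-just i prev (a ∷ v) found with a ≟ᶠ i
  ... | yes a≡i = inj₁ (a≡i , found)
  phiScan-just i prev (a ∷ b ∷ v) found | no _ with phiScan-just i (just a) (b ∷ v) found
  ... | inj₁ (b≡i , a≡c′)      = inj₂ (zero , b≡i , just-injective a≡c′)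
  ... | inj₂ (y , at-y , at-y′) = inj₂ (suc y , at-y , at-y′)

  φ-adjacent : ∀ j {c c′} → φ j c ≡ just c′ → Adjacent j c′ c
  φ-adjacent j {c} found with phiScan-just c nothing (paCol j) found
  ... | inj₂ (y , c-at , c′-at) = y , c′-at , c-at

  runTop-≢ : ∀ j y → S (pa j (suc y)) j ≢ S (pa j (inject₁ y)) j → T (runTop j (suc y))
  runTop-≢ j y differ with S (pa j (suc y)) j ≡ᵇ S (pa j (inject₁ y)) j in same
  ... | true  = differ (≡ᵇ⇒≡ _ _ (Equivalence.from T-≡ same))
  ... | false = _

  nothing-between : ∀ k q {c} → Colex k (pa (suc k) (inject₁ q)) c → ¬ Colex k c (pa (suc k) (suc q))
  nothing-between k q {c} q≺c c≺q+1 with r , refl ← pa-surjective (suc k) c =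
    inject₁<⇒≮suc (pa-reflects k q≺c) (pa-reflects k c≺q+1)

  precedes-neighbour : ∀ k y {a} → Colex k a (pa (suc k) (suc y)) → a ≢ pa (suc k) (inject₁ y) →
    Colex k a (pa (suc k) (inject₁ y))
  precedes-neighbour k y {a} a≺y+1 a≢y with r , refl ← pa-surjective (suc k) a =
    pa-monotone k (<suc∧≢inject₁⇒< (pa-reflects k a≺y+1) (a≢y ∘ cong (pa (suc k))))

  Adjacent-suc : ∀ k {c′ c} → Adjacent (suc (suc k)) c′ c →
    HasRunTop (suc k) c ⊎ Adjacent (suc k) c′ c
  Adjacent-suc k {c′} {c} (y , c′-at , c-at) with pa-surjective (suc k) c
  ... | zero  , refl = inj₁ (zero , _ , refl)
  ... | suc q , refl with S (pa (suc k) (inject₁ q)) (suc k) ≟ S (pa (suc k) (suc q)) (suc k)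
  ...   | no differ = inj₁ (suc q , runTop-≢ (suc k) q (differ ∘ sym) , refl)
  ...   | yes same with pa (suc k) (inject₁ q) ≟ᶠ c′
  ...     | yes a≡c′ = inj₂ (q , a≡c′ , refl)
  ...     | no a≢c′  = ⊥-elim (nothing-between k q (proj₁ squeezed) (proj₂ squeezed))
    where
      -- a, directly above c in column suc k and sharing its character there, still precedes c in
      -- column suc (suc k), hence also precedes c′; squeezing moves c′ between a and c in column suc k.
      a≺c : Colex (suc k) (pa (suc k) (inject₁ q)) (pa (suc k) (suc q))
      a≺c = inj₂ (same , pa-monotone k (≤̄⇒inject₁< ≤-refl))
      a≺c′ : Colex (suc k) (pa (suc k) (inject₁ q)) c′
      a≺c′ = subst (Colex (suc k) _) c′-at
        (precedes-neighbour (suc k) y (subst (Colex (suc k) _) (sym c-at) a≺c) (a≢c′ ∘ flip trans c′-at))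
      c′≺c : Colex (suc k) c′ (pa (suc k) (suc q))
      c′≺c = subst₂ (Colex (suc k)) c′-at c-at (pa-monotone (suc k) (≤̄⇒inject₁< ≤-refl))
      squeezed : Colex k (pa (suc k) (inject₁ q)) c′ × Colex k c′ (pa (suc k) (suc q))
      squeezed = Colex-squeeze k same a≺c′ c′≺c

  lists : State → Hap → List Interval × List Interval
  lists st c = Ls st c , RS st c

  update-≡ : ∀ c v (f : Hap → List Interval) → update c v f c ≡ v
  update-≡ c v f with c ≟ᶠ c
  ... | yes _  = refl
  ... | no c≢c = ⊥-elim (c≢c refl)

  update-≢ : ∀ {c c″} v (f : Hap → List Interval) → c″ ≢ c → update c v f c″ ≡ f c″
  update-≢ {c} {c″} v f c″≢c with c″ ≟ᶠ c
  ... | yes c″≡c = ⊥-elim (c″≢c c″≡c)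
  ... | no _     = refl

  step-elsewhere : ∀ j st p {c} → pa j p ≢ c → lists (step j st p) c ≡ lists st c
  step-elsewhere j st p p≢c with Ls st (pa j p)
  ... | [] = refl
  ... | (b , e) ∷ rest with e ≡ᵇ j
  ...   | true  = cong₂ _,_ (update-≢ _ (Ls st) (p≢c ∘ sym)) (update-≢ _ (RS st) (p≢c ∘ sym))
  ...   | false with activeCond j p b st
  ...     | true  = cong₂ _,_ (update-≢ _ (Ls st) (p≢c ∘ sym)) (update-≢ _ (RS st) (p≢c ∘ sym))
  ...     | false = refl

  steps-elsewhere : ∀ j st {ps c} → All (λ p → pa j p ≢ c) ps →
    lists (foldl (step j) st ps) c ≡ lists st c
  steps-elsewhere j st []          = refl
  steps-elsewhere j st (p≢c ∷ ps≢c) = trans (steps-elsewhere j _ ps≢c) (step-elsewhere j st _ p≢c)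

  data StepView (j : ℕ) (st : State) (p : Hap) : State → Set where
    empty   : Ls st (pa j p) ≡ [] → StepView j st p st
    passive : ∀ {st′} b rest → Ls st (pa j p) ≡ (b , j) ∷ rest →
              Ls st′ (pa j p) ≡ rest →
              RS st′ (pa j p) ≡ RS st (pa j p) ∷ʳ (b , j) → StepView j st p st′
    active  : ∀ {st′} b e rest → Ls st (pa j p) ≡ (b , e) ∷ rest → e ≢ j →
              Ls st′ (pa j p) ≡ (suc j , e) ∷ rest →
              RS st′ (pa j p) ≡ RS st (pa j p) ∷ʳ (b , j) → StepView j st p st′
    idle    : ∀ b e rest → Ls st (pa j p) ≡ (b , e) ∷ rest → e ≢ j →
              activeCond j p b st ≡ false → StepView j st p st

  step-view : ∀ j st p → StepView j st p (step j st p)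
  step-view j st p with Ls st (pa j p) in ls
  ... | [] = empty ls
  ... | (b , e) ∷ rest with e ≡ᵇ j in e≟j
  ...   | true with refl ← ≡ᵇ⇒≡ e j (Equivalence.from T-≡ e≟j) =
    passive b rest ls (update-≡ (pa j p) rest (Ls st)) (update-≡ (pa j p) _ (RS st))
  ...   | false with activeCond j p b st in ac
  ...     | true  = active b e rest ls e≢j (update-≡ (pa j p) _ (Ls st)) (update-≡ (pa j p) _ (RS st))
    where e≢j = λ e≡j → subst T e≟j (≡⇒≡ᵇ e j e≡j)
  ...     | false = idle b e rest ls e≢j ac
    where e≢j = λ e≡j → subst T e≟j (≡⇒≡ᵇ e j e≡j)

  positions : List Hap
  positions = List.allFin (suc n)

  stateAfter-foldl : ∀ j x →
    stateAfter j x ≡ foldl (step j) (runColumns (j ∸ 1)) (take (suc (toℕ x)) positions)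
  stateAfter-foldl j x = sym (trans
    (cong (foldl (step j) (runColumns (j ∸ 1))) (take-suc-tabulate (λ i → i) x))
    (foldl-∷ʳ (step j) (runColumns (j ∸ 1)) x (take (toℕ x) positions)))

  stateBefore-suc : ∀ j y → stateBefore j (suc y) ≡ stateAfter j (inject₁ y)
  stateBefore-suc j y = trans
    (cong (λ t → foldl (step j) (runColumns (j ∸ 1)) (take (suc t) positions)) (sym (toℕ-inject₁ y)))
    (sym (stateAfter-foldl j (inject₁ y)))

  runColumns-from : ∀ k x →
    runColumns (suc k) ≡ foldl (step (suc k)) (stateAfter (suc k) x) (drop (suc (toℕ x)) positions)
  runColumns-from k x = begin
    foldl s (runColumns k) positions
      ≡⟨ cong (foldl s (runColumns k)) (take++drop≡id t positions) ⟨
    foldl s (runColumns k) (take t positions ++ drop t positions)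
      ≡⟨ foldl-++ s (runColumns k) (take t positions) (drop t positions) ⟩
    foldl s (foldl s (runColumns k) (take t positions)) (drop t positions)
      ≡⟨ cong (λ st → foldl s st (drop t positions)) (stateAfter-foldl (suc k) x) ⟨
    foldl s (stateAfter (suc k) x) (drop t positions)
      ∎
    where
      open ≡-Reasoning
      s = step (suc k)
      t = suc (toℕ x)

  stateBefore-own : ∀ k x →
    lists (stateBefore (suc k) x) (pa (suc k) x) ≡ lists (runColumns k) (pa (suc k) x)
  stateBefore-own k x = steps-elsewhere (suc k) _ (All-take-tabulate (λ i → i) (toℕ x)
    (λ p p<x p≡x → <-irrefl (cong toℕ (pa-injective k p≡x)) p<x))

  runColumns-own : ∀ k x →
    lists (runColumns (suc k)) (pa (suc k) x) ≡ lists (stateAfter (suc k) x) (pa (suc k) x)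
  runColumns-own k x = trans (cong (λ st → lists st (pa (suc k) x)) (runColumns-from k x))
    (steps-elsewhere (suc k) _ (All-drop-tabulate (λ i → i) (suc (toℕ x))
      (λ p x<p p≡x → <-irrefl (cong toℕ (sym (pa-injective k p≡x))) x<p)))

  StepView-RS : ∀ {j st p st′} → StepView j st p st′ → ExtendsAt j (RS st (pa j p)) (RS st′ (pa j p))
  StepView-RS (empty _)                 = inj₁ refl
  StepView-RS (passive b _ _ _ rs′)     = inj₂ (b , rs′)
  StepView-RS (active b _ _ _ _ _ rs′)  = inj₂ (b , rs′)
  StepView-RS (idle _ _ _ _ _ _)        = inj₁ refl

  -- L_c, when es are the ends of the remaining haplotype intervals and the current one starts at b.
  resume : ℕ → List ℕ → List Interval
  resume b []       = []
  resume b (e ∷ es) = (b , e) ∷ mkIntervals e es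

  mkIntervals-resume : ∀ p es → mkIntervals p es ≡ resume (suc p) es
  mkIntervals-resume p []      = refl
  mkIntervals-resume p (_ ∷ _) = refl

  resume-[] : ∀ {b} es → resume b es ≡ [] → es ≡ []
  resume-[] [] _ = refl

  resume-∷ : ∀ {b b′ e rest} es → resume b es ≡ (b′ , e) ∷ rest →
    b′ ≡ b × ∃[ es′ ] es ≡ e ∷ es′ × rest ≡ mkIntervals e es′
  resume-∷ (_ ∷ es′) refl = refl , es′ , refl , refl

  breaks-increasing : ∀ c → AllPairs _<_ (breaks c)
  breaks-increasing c = AllPairs.filter⁺ (T? ∘ _)
    (subst (AllPairs _<_) (sym (map-upTo suc m)) (AllPairs.applyUpTo⁺₁ suc m (λ i<j _ → s<s i<j)))

  breaks-positive : ∀ c → All (0 <_) (breaks c)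
  breaks-positive c = All.filter⁺ _ (All.map⁺ {f = suc} (All.universal (λ _ → z<s) (List.upTo m)))

  runTop∈breaks : ∀ k c → suc k ≤ m → HasRunTop (suc k) c → suc k ∈ breaks c
  runTop∈breaks k c k<m (x , top , refl) =
    ∈-filter⁺ (T? ∘ _) (∈-map⁺ suc (∈-upTo⁺ k<m)) (Equivalence.from (T-∨ {suc k ≡ᵇ m}) (inj₂ top-here))
    where
      top-here : T (any (λ x′ → runTop (suc k) x′ ∧ (pa (suc k) x′ ==ᶠ pa (suc k) x)) positions)
      top-here = any⁺ _ (lose (∈-allFin x) (Equivalence.from T-∧ (top , fromWitness refl)))

  module Column (k : ℕ) (x : Hap) where
    c : Hap
    c = pa (suc k) x

    before : State
    before = stateBefore (suc k) x

    data PendingStep (b : ℕ) : Set where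
      advanced  : ∀ es → after (suc k) (breaks c) ≡ es →
                  Ls (runColumns (suc k)) c ≡ resume (suc (suc k)) es → PendingStep b
      unchanged : after (suc k) (breaks c) ≡ after k (breaks c) →
                  Ls (runColumns (suc k)) c ≡ Ls (runColumns k) c →
                  suc k ∉ breaks c → activeCond (suc k) x b before ≡ false → PendingStep b

    pending-step : ∀ {b} → Ls (runColumns k) c ≡ resume b (after k (breaks c)) → PendingStep b
    pending-step {b} shape = go (step-view (suc k) before x) (cong proj₁ (runColumns-own k x))
      where
        shape-before : Ls before c ≡ resume b (after k (breaks c))
        shape-before = trans (cong proj₁ (stateBefore-own k x)) shape
        go : ∀ {st′} → StepView (suc k) before x st′ →
          Ls (runColumns (suc k)) c ≡ Ls st′ c → PendingStep b
        go (empty ls) now = advanced [] (trans (sym (after-suc k (breaks c))) (cong (after (suc k)) none-left))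
                                        (trans now ls)
          where none-left = resume-[] _ (trans (sym shape-before) ls)
        go (passive _ rest ls ls′ _) now with resume-∷ _ (trans (sym shape-before) ls)
        ... | refl , es , first , refl with after-suc-∷ _ (breaks-increasing c) first
        ...   | inj₁ (_ , next)         =
          advanced es next (trans now (trans ls′ (mkIntervals-resume (suc k) es)))
        ...   | inj₂ (k+1<k+1 , _)      = ⊥-elim (<-irrefl refl k+1<k+1)
        go (active _ e rest ls e≢j ls′ _) now with resume-∷ _ (trans (sym shape-before) ls)
        ... | refl , es , first , refl with after-suc-∷ _ (breaks-increasing c) first
        ...   | inj₁ (e≡j , _)          = ⊥-elim (e≢j e≡j)
        ...   | inj₂ (_ , next , _)     = advanced (e ∷ es) next (trans now ls′)
        go (idle _ e rest ls e≢j inactive) now with resume-∷ _ (trans (sym shape-before) ls)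
        ... | refl , es , first , refl with after-suc-∷ _ (breaks-increasing c) first
        ...   | inj₁ (e≡j , _)          = ⊥-elim (e≢j e≡j)
        ...   | inj₂ (_ , next , j∉)    =
          unchanged (trans next (sym first)) (trans now (cong proj₁ (stateBefore-own k x))) j∉ inactive

    RS-own-step : ExtendsAt (suc k) (RS (runColumns k) c) (RS (stateAfter (suc k) x) c)
    RS-own-step = subst (λ xs → ExtendsAt (suc k) xs (RS (stateAfter (suc k) x) c))
                        (cong proj₂ (stateBefore-own k x)) (StepView-RS (step-view (suc k) before x))

    RS-column : ExtendsAt (suc k) (RS (runColumns k) c) (RS (runColumns (suc k)) c)
    RS-column = subst (ExtendsAt (suc k) (RS (runColumns k) c))
                      (sym (cong proj₂ (runColumns-own k x))) RS-own-step

    appended-first : ∀ {b} → RS (stateAfter (suc k) x) c ≡ RS before c ∷ʳ (b , suc k) →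
      ∃[ e ] ∃[ rest ] Ls (runColumns k) c ≡ (b , e) ∷ rest
    appended-first {b} = go (step-view (suc k) before x)
      where
        go : ∀ {st′} → StepView (suc k) before x st′ → RS st′ c ≡ RS before c ∷ʳ (b , suc k) →
          ∃[ e ] ∃[ rest ] Ls (runColumns k) c ≡ (b , e) ∷ rest
        go (empty _) appended = ⊥-elim (∷ʳ-≢ _ (sym appended))
        go (idle _ _ _ _ _ _) appended = ⊥-elim (∷ʳ-≢ _ (sym appended))
        go (passive _ rest ls _ rs′) appended
          with refl ← cong proj₁ (∷ʳ-injectiveʳ _ _ (trans (sym rs′) appended)) =
          suc k , rest , trans (sym (cong proj₁ (stateBefore-own k x))) ls
        go (active _ e rest ls _ _ rs′) appended
          with refl ← cong proj₁ (∷ʳ-injectiveʳ _ _ (trans (sym rs′) appended)) =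
          e , rest , trans (sym (cong proj₁ (stateBefore-own k x))) ls

  open Column using (advanced; unchanged)

  RS-neighbour : ∀ k y → ExtendsAt (suc k) (RS (runColumns k) (pa (suc k) (inject₁ y)))
                                           (RS (stateBefore (suc k) (suc y)) (pa (suc k) (inject₁ y)))
  RS-neighbour k y rewrite stateBefore-suc (suc k) y = Column.RS-own-step k (inject₁ y)

  RS-neighbour-after : ∀ k y → RS (runColumns (suc k)) (pa (suc k) (inject₁ y))
                             ≡ RS (stateBefore (suc k) (suc y)) (pa (suc k) (inject₁ y))
  RS-neighbour-after k y rewrite stateBefore-suc (suc k) y = cong proj₂ (runColumns-own k (inject₁ y))

  record Invariant (k : ℕ) : Set where
    field
      refined-ends : ∀ c → EndsBy k (RS (runColumns k) c)
      pending      : ∀ c → ∃[ b ] Ls (runColumns k) c ≡ resume b (after k (breaks c))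
      neighbour-<  : ∀ {c′ c} → Adjacent (suc k) c′ c →
                     ∀ {b e rest} → Ls (runColumns k) c ≡ (b , e) ∷ rest →
                     overlapCount (b , k) (RS (runColumns k) c′) < d

  invariant-zero : 0 < d → Invariant 0
  invariant-zero 0<d = record
    { refined-ends = λ _ → []
    ; pending      = λ c → 1 , trans (mkIntervals-resume 0 (breaks c))
                                     (cong (resume 1) (sym (filter-all (0 <?_) (breaks-positive c))))
    ; neighbour-<  = λ _ _ → 0<d
    }

  module _ (0<d : 0 < d) (k : ℕ) (k<m : suc k ≤ m) (inv : Invariant k) where
    open Invariant inv

    idle-neighbour-< : ∀ y {b e rest} → Ls (runColumns k) (pa (suc k) (suc y)) ≡ (b , e) ∷ rest →
      activeCond (suc k) (suc y) b (stateBefore (suc k) (suc y)) ≡ false →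
      overlapCount (b , suc k) (RS (runColumns (suc k)) (pa (suc k) (inject₁ y))) < d
    idle-neighbour-< y {b} first inactive rewrite RS-neighbour-after k y =
      ≤∧≢⇒< (≤-trans (overlapCount-ExtendsAt b (refined-ends _) (RS-neighbour k y))
                      (neighbour-< (y , refl , refl) first))
            (λ count≡d → subst T inactive (≡⇒≡ᵇ _ _ count≡d))

    neighbour-step : ∀ {c′ c} → Adjacent (suc (suc k)) c′ c → ∀ {b e rest} →
      Ls (runColumns (suc k)) c ≡ (b , e) ∷ rest →
      overlapCount (b , suc k) (RS (runColumns (suc k)) c′) < d
    neighbour-step {c′} {c} adj {b} first with x , refl ← pa-surjective (suc k) c
      with b₀ , shape ← pending (pa (suc k) x)
      with Column.pending-step k x shape
    ... | advanced es _ now with refl , _ ← resume-∷ es (trans (sym now) first) =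
      subst (_< d) (sym (overlapCount-empty (suc (suc k)) (suc k) (RS (runColumns (suc k)) c′) ≤-refl)) 0<d
    ... | unchanged _ now k+1∉ inactive
      with refl , _ ← resume-∷ _ (trans (sym shape) (trans (sym now) first))
      with Adjacent-suc k adj
    ...   | inj₁ top = ⊥-elim (k+1∉ (runTop∈breaks k _ k<m top))
    ...   | inj₂ (y , refl , c-at) with refl ← pa-injective k c-at =
      idle-neighbour-< y (trans (sym now) first) inactive

    invariant-suc : Invariant (suc k)
    invariant-suc = record { refined-ends = ends ; pending = pend ; neighbour-< = neighbour-step }
      where
        ends : ∀ c → EndsBy (suc k) (RS (runColumns (suc k)) c)
        ends c with x , refl ← pa-surjective (suc k) c =
          ExtendsAt-ends (refined-ends _) (Column.RS-column k x)
        pend : ∀ c → ∃[ b ] Ls (runColumns (suc k)) c ≡ resume b (after (suc k) (breaks c))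
        pend c with x , refl ← pa-surjective (suc k) c
          with b , shape ← pending (pa (suc k) x)
          with Column.pending-step k x shape
        ... | advanced es next now = suc (suc k) , trans now (cong (resume _) (sym next))
        ... | unchanged next now _ _ = b , trans now (trans shape (cong (resume b) (sym next)))

  invariant : 0 < d → ∀ k → k ≤ m → Invariant k
  invariant 0<d zero    _   = invariant-zero 0<d
  invariant 0<d (suc k) k<m = invariant-suc 0<d k k<m (invariant 0<d k (<⇒≤ k<m))

  appended-overlapCount< : 0 < d → ∀ k → suc k ≤ m → ∀ x {b c′ pre s} →
    RS (stateAfter (suc k) x) (pa (suc k) x) ≡ RS (stateBefore (suc k) x) (pa (suc k) x) ∷ʳ (b , suc k) →
    φ (suc k) (pa (suc k) x) ≡ just c′ → RS (stateBefore (suc k) x) c′ ≡ pre ∷ʳ s → proj₂ s < suc k →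
    overlapCount (b , suc k) (RS (stateBefore (suc k) x) c′) < d
  appended-overlapCount< 0<d k k<m x {b} {c′} appended φ≡c′ last s<j
    with y , refl , c-at ← φ-adjacent (suc k) φ≡c′
    with refl ← pa-injective k c-at
    with e , rest , first ← Column.appended-first k (suc y) appended = begin-strict
      overlapCount (b , suc k) (RS (stateBefore (suc k) (suc y)) c′)
        ≡⟨ cong (overlapCount (b , suc k)) (ExtendsAt-last< (RS-neighbour k y) last s<j) ⟩
      overlapCount (b , suc k) (RS (runColumns k) c′)
        ≡⟨ overlapCount-suc b k (refined-ends c′) ⟩
      overlapCount (b , k) (RS (runColumns k) c′)
        <⟨ neighbour-< (y , refl , refl) first ⟩
      d ∎
    where
      open Invariant (invariant 0<d k (<⇒≤ k<m))
      open ≤-Reasoning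

lemma8 : ∀ {h : ℕ} (S : Fin h → ℕ → ℕ) (m d : ℕ) → 1 < d →
    (j : ℕ) → 1 ≤ j → j ≤ m → (x : Fin h) → (b : ℕ) →
    Algo.refined S m d (Algo.stateAfter S m d j x) (Algo.pa S m d j x)
      ≡ Algo.refined S m d (Algo.stateBefore S m d j x) (Algo.pa S m d j x) ∷ʳ (b , j) →
    (c′ : Fin h) → Algo.φ S m d j (Algo.pa S m d j x) ≡ just c′ →
    (Σ (List Interval) λ pre → Σ Interval λ s →
      (Algo.refined S m d (Algo.stateBefore S m d j x) c′ ≡ pre ∷ʳ s) × (proj₂ s < j)) →
    overlapCount (b , j) (Algo.refined S m d (Algo.stateBefore S m d j x) c′) < d
lemma8 {zero}  _ _ _ _ _ _ _ ()
lemma8 {suc n} S m d 1<d (suc k) _ k<m x b appended c′ φ≡c′ (_ , _ , last , s<j) =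
  Decomposition.appended-overlapCount< S m d (<-trans z<s 1<d) k k<m x appended φ≡c′ last s<j
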